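{- Let $\mathcal{G}$ be a graph class with the SQGM property and let $\Pi$ be a minor-bidimensional problem. Then there exist constants $\alpha>0$ and $0<\epsilon<1$ such that for every graph $G\in\mathcal{G}$, $\operatorname{tw}(G)\le\alpha\cdot(OPT_\Pi(G))^{\epsilon}$.
   Context: A vertex/edge subset problem $\Pi$ is given by a predicate $\phi(G,S)$, $S\subseteq V(G)$ or $S\subseteq E(G)$. $(G,k)\in\Pi$ iff some feasible $S$ has $|S|\le k$ (minimization) or $|S|\ge k$ (maximization). $OPT_\Pi(G)$ is the minimum (resp. maximum) $k$ with $(G,k)\in\Pi$. $\Pi$ is minor-closed if contracting an edge, deleting an edge or deleting a vertex never increases $OPT_\Pi$. $\Pi$ is minor-bidimensional if it is minor-closed and there is $c>0$ with $OPT_\Pi(\boxplus_k)\ge ck^2$ for all $k$, where $\boxplus_k$ is the $k\times k$ grid. $\mathcal{G}$ has the SQGM property if there exist constants $\lambda>0$ and $1\le c<2$ such that every $G\in\mathcal{G}$ that excludes $\boxplus_t$ as a minor has treewidth at most $\lambda t^c$. -}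

module Defs where

open import Data.Nat using (ℕ; zero; suc; _+_; _*_; _^_; _≤_; _<_; _≡ᵇ_; _<ᵇ_)
open import Data.Bool using (Bool; true; false; _∧_; _∨_; if_then_else_)
open import Data.Bool.Properties using (∨-comm; ∧-zeroʳ)
open import Data.Fin using (Fin; toℕ; remQuot; inject₁; fromℕ) renaming (zero to fzero; suc to fsuc)
open import Data.Fin.Subset using (Subset; _∈_; _∉_; ∣_∣)
open import Data.List using (List; map; allFin)
open import Data.Nat.ListAction using (sum)
open import Data.Product using (Σ; ∃; _×_; _,_; proj₁; proj₂)
open import Relation.Nullary using (¬_)
open import Relation.Binary.PropositionalEquality using (_≡_; _≢_; refl; cong₂)
open import Function.Definitions using (Injective)

record Graph : Set where
  field
    size   : ℕ
    adj    : Fin size → Fin size → Bool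
    sym    : ∀ i j → adj i j ≡ adj j i
    irrefl : ∀ i → adj i i ≡ false
open Graph public

Edge : (G : Graph) → Fin (size G) → Fin (size G) → Set
Edge G i j = adj G i j ≡ true

data ReachIn (G : Graph) (U : Fin (size G) → Set) (x : Fin (size G)) : Fin (size G) → Set where
  here : U x → ReachIn G U x x
  step : ∀ {y z} → ReachIn G U x y → Edge G y z → U z → ReachIn G U x z

ConnectedIn : (G : Graph) → (Fin (size G) → Set) → Set
ConnectedIn G U = ∀ x y → U x → U y → ReachIn G U x y

Connected : Graph → Set
Connected G = ConnectedIn G (λ _ → Data.Unit.⊤)
  where import Data.Unit

-- a cycle of length k+3: distinct vertices v0,...,v_{k+2}, consecutive adjacent, closing edge
record Cycle (G : Graph) : Set where
  field
    len   : ℕ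
    vtx   : Fin (suc (suc (suc len))) → Fin (size G)
    inj   : Injective _≡_ _≡_ vtx
    edges : ∀ (i : Fin (suc (suc len))) → Edge G (vtx (inject₁ i)) (vtx (fsuc i))
    close : Edge G (vtx (fromℕ (suc (suc len)))) (vtx fzero)

Acyclic : Graph → Set
Acyclic G = ¬ Cycle G

IsTree : Graph → Set
IsTree T = (0 < size T) × Connected T × Acyclic T

record _≼_ (H G : Graph) : Set where
  field
    branch    : Fin (size H) → Subset (size G)
    nonempty  : ∀ i → ∃ λ x → x ∈ branch i
    connected : ∀ i → ConnectedIn G (λ x → x ∈ branch i)
    disjoint  : ∀ i j x → i ≢ j → x ∈ branch i → x ∉ branch j
    edges     : ∀ i j → Edge H i j →
                ∃ λ x → ∃ λ y → x ∈ branch i × y ∈ branch j × Edge G x y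

record TreeDecomposition (G : Graph) (w : ℕ) : Set where
  field
    tree      : Graph
    isTree    : IsTree tree
    bag       : Fin (size tree) → Subset (size G)
    vcover    : ∀ v → ∃ λ t → v ∈ bag t
    ecover    : ∀ u v → Edge G u v → ∃ λ t → u ∈ bag t × v ∈ bag t
    coherent  : ∀ v → ConnectedIn tree (λ t → v ∈ bag t)
    bagSize   : ∀ t → ∣ bag t ∣ ≤ suc w

TwAtMost : Graph → ℕ → Set
TwAtMost G w = TreeDecomposition G w

private
  sucNeq : ∀ n → (suc n ≡ᵇ n) ≡ false
  sucNeq zero = refl
  sucNeq (suc n) = sucNeq n

gridNextℕ : ℕ → ℕ → ℕ → ℕ → Bool
gridNextℕ a b c d = ((a ≡ᵇ c) ∧ (suc b ≡ᵇ d)) ∨ ((b ≡ᵇ d) ∧ (suc a ≡ᵇ c))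

row col : ∀ k → Fin (k * k) → ℕ
row k x = toℕ (proj₁ (remQuot {k} k x))
col k x = toℕ (proj₂ (remQuot {k} k x))

gridNext : ∀ k → Fin (k * k) → Fin (k * k) → Bool
gridNext k x y = gridNextℕ (row k x) (col k x) (row k y) (col k y)

private
  gridNextℕIrrefl : ∀ a b → gridNextℕ a b a b ≡ false
  gridNextℕIrrefl a b rewrite sucNeq a | sucNeq b
    | ∧-zeroʳ (a ≡ᵇ a) | ∧-zeroʳ (b ≡ᵇ b) = refl

  gridNextIrrefl : ∀ k x → gridNext k x x ≡ false
  gridNextIrrefl k x = gridNextℕIrrefl (row k x) (col k x)

grid : ℕ → Graph
grid k = record
  { size   = k * k
  ; adj    = λ x y → gridNext k x y ∨ gridNext k y x
  ; sym    = λ x y → ∨-comm (gridNext k x y) (gridNext k y x)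
  ; irrefl = λ x → cong₂ _∨_ (gridNextIrrefl k x) (gridNextIrrefl k x)
  }

data SubsetKind : Set where
  vertexSubset edgeSubset : SubsetKind

data Objective : Set where
  minimization maximization : Objective

record EdgeSubset (G : Graph) : Set where
  field
    mem    : Fin (size G) → Fin (size G) → Bool
    memSym : ∀ i j → mem i j ≡ mem j i
    memE   : ∀ i j → mem i j ≡ true → Edge G i j
open EdgeSubset public

edgeCount : {G : Graph} → EdgeSubset G → ℕ
edgeCount {G} S =
  sum (map (λ i → sum (map (λ j → if mem S i j ∧ (toℕ i <ᵇ toℕ j) then 1 else 0)
                           (allFin (size G))))
           (allFin (size G)))

Solution : SubsetKind → Graph → Set
Solution vertexSubset G = Subset (size G)
Solution edgeSubset   G = EdgeSubset G

card : (κ : SubsetKind) → (G : Graph) → Solution κ G → ℕ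
card vertexSubset G S = ∣ S ∣
card edgeSubset   G S = edgeCount S

record Problem : Set₁ where
  field
    kind      : SubsetKind
    objective : Objective
    φ         : (G : Graph) → Solution kind G → Set
open Problem public

-- OPT_Π(G) ≤ m  (with the conventions min ∅ = +∞, max ∅ = -∞)
OptAtMost : Problem → Graph → ℕ → Set
OptAtMost Π G m with objective Π
... | minimization = ∃ λ (S : Solution (kind Π) G) → φ Π G S × card (kind Π) G S ≤ m
... | maximization = ∀ (S : Solution (kind Π) G) → φ Π G S → card (kind Π) G S ≤ m

MinorClosed : Problem → Set
MinorClosed Π = ∀ H G → H ≼ G → ∀ m → OptAtMost Π G m → OptAtMost Π H m

-- minor-bidimensional: minor-closed and OPT(grid k) ≥ c k² for a constant c = 1/b > 0
MinorBidimensional : Problem → Set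
MinorBidimensional Π =
  MinorClosed Π ×
  (∃ λ b → 1 ≤ b × (∀ k m → OptAtMost Π (grid k) m → k * k ≤ b * m))

-- SQGM with constants λ (natural, ≥ 1) and c = p/q ∈ [1,2) rational:
-- G ∈ 𝒢 excluding grid t as a minor ⇒ tw(G) ≤ λ t^(p/q), i.e. tw(G)^q ≤ λ^q t^p
SQGM : (Graph → Set) → Set
SQGM 𝒢 = ∃ λ lam → ∃ λ p → ∃ λ q →
  1 ≤ lam × 1 ≤ q × q ≤ p × p < 2 * q ×
  (∀ G → 𝒢 G → ∀ t → ¬ (grid t ≼ G) →
     ∃ λ w → TwAtMost G w × w ^ q ≤ lam ^ q * t ^ p)

-- If OPT_Π(G) ≤ m then G excludes every grid of side T with b·m < T², and
-- such a T can be chosen with T² ≤ 4·b·m.  SQGM then bounds tw(G) by λ·T^c,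
-- so tw(G) ≤ λ·(4·b·m)^(c/2) with exponent c/2 < 1.  If m = 0, G cannot
-- even contain the 1 × 1 grid, so it has no vertices.
module Submission where

open import Defs
open import Data.Nat using (ℕ; zero; suc; _+_; _*_; _^_; _≤_; _<_; z≤n; s≤s; NonZero; _<?_)
open import Data.Nat.Properties
open import Data.Nat.Solver using (module +-*-Solver)
open import Data.Bool using (false)
open import Data.Empty using (⊥; ⊥-elim)
open import Data.Unit using (tt)
open import Data.Fin using (Fin) renaming (zero to fzero; suc to fsuc)
open import Data.Fin.Subset using (⁅_⁆; _∈_) renaming (⊥ to ∅)
open import Data.Fin.Subset.Properties using (x∈⁅x⁆; x∈⁅y⁆⇒x≡y; ∣⊥∣≡0)
open import Data.Product using (∃; _×_; _,_)
open import Relation.Nullary using (¬_; yes; no)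
open import Relation.Binary.PropositionalEquality
  using (_≡_; refl; trans; cong; cong₂; module ≡-Reasoning)
  renaming (sym to ≡-sym)

open +-*-Solver using (solve; _:+_; _:*_; _:=_; con)

^-distrib-* : ∀ x y n → (x * y) ^ n ≡ x ^ n * y ^ n
^-distrib-* x y zero    = refl
^-distrib-* x y (suc n) = begin
  (x * y) * (x * y) ^ n       ≡⟨ cong ((x * y) *_) (^-distrib-* x y n) ⟩
  (x * y) * (x ^ n * y ^ n)   ≡⟨ solve 4 (λ x y u v → (x :* y) :* (u :* v) := (x :* u) :* (y :* v))
                                   refl x y (x ^ n) (y ^ n) ⟩
  (x * x ^ n) * (y * y ^ n)   ∎
  where open ≡-Reasoning

^-double : ∀ x n → x ^ (2 * n) ≡ x ^ n * x ^ n
^-double x n = trans (^-distribˡ-+-* x n (n + 0)) (cong (λ k → x ^ n * x ^ k) (+-identityʳ n))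

suc-square≤4*square : ∀ t → suc (suc t) * suc (suc t) ≤ 4 * (suc t * suc t)
suc-square≤4*square t = begin
  suc (suc t) * suc (suc t)       ≤⟨ *-mono-≤ double double ⟩
  (suc t + suc t) * (suc t + suc t) ≡⟨ solve 1 (λ x → (x :+ x) :* (x :+ x) := con 4 :* (x :* x)) refl (suc t) ⟩
  4 * (suc t * suc t)             ∎
  where
  open ≤-Reasoning
  double : suc (suc t) ≤ suc t + suc t
  double = s≤s (m≤n+m (suc t) t)

-- Squares at most quadruple from one to the next, so one lands in (n, 4n].
square-between : ∀ n → 1 ≤ n → ∃ λ T → n < T * T × T * T ≤ 4 * n
square-between (suc zero)     _ = 2 , s≤s (s≤s z≤n) , ≤-refl
square-between (suc (suc n))  _ with square-between (suc n) (s≤s z≤n)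
... | zero  , () , _
... | suc t , n<T² , T²≤4n with suc (suc n) <? suc t * suc t
...   | yes n+1<T² = suc t , n+1<T² , ≤-trans T²≤4n (*-monoʳ-≤ 4 (n≤1+n (suc n)))
...   | no  n+1≮T² = suc (suc t) , n+1<T'² ,
                     ≤-trans (suc-square≤4*square t) (*-monoʳ-≤ 4 (≤-reflexive (≡-sym T²≡n+1)))
  where
  T²≡n+1 : suc (suc n) ≡ suc t * suc t
  T²≡n+1 = ≤-antisym n<T² (≮⇒≥ n+1≮T²)
  n+1<T'² : suc (suc n) < suc (suc t) * suc (suc t)
  n+1<T'² = ≤-<-trans (≤-reflexive T²≡n+1) (*-mono-< (n<1+n (suc t)) (n<1+n (suc t)))

^-bound-squared : ∀ w l T {N} p q → w ^ q ≤ l ^ q * T ^ p → T * T ≤ N →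
                  w ^ (2 * q) ≤ l ^ (2 * q) * N ^ p
^-bound-squared w l T {N} p q w^q≤ T²≤N = begin
  w ^ (2 * q)                           ≡⟨ ^-double w q ⟩
  w ^ q * w ^ q                         ≤⟨ *-mono-≤ w^q≤ w^q≤ ⟩
  (l ^ q * T ^ p) * (l ^ q * T ^ p)     ≡⟨ solve 2 (λ x y → (x :* y) :* (x :* y) := (x :* x) :* (y :* y))
                                             refl (l ^ q) (T ^ p) ⟩
  (l ^ q * l ^ q) * (T ^ p * T ^ p)     ≡⟨ cong₂ _*_ (≡-sym (^-double l q)) (≡-sym (^-distrib-* T T p)) ⟩
  l ^ (2 * q) * (T * T) ^ p             ≤⟨ *-monoʳ-≤ (l ^ (2 * q)) (^-monoˡ-≤ p T²≤N) ⟩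
  l ^ (2 * q) * N ^ p                   ∎
  where open ≤-Reasoning

absorb-constant : ∀ l c m {p r} .{{_ : NonZero c}} → p ≤ r →
                  l ^ r * (c * m) ^ p ≤ (l * c) ^ r * m ^ p
absorb-constant l c m {p} {r} p≤r = begin
  l ^ r * (c * m) ^ p       ≡⟨ cong (l ^ r *_) (^-distrib-* c m p) ⟩
  l ^ r * (c ^ p * m ^ p)   ≤⟨ *-monoʳ-≤ (l ^ r) (*-monoˡ-≤ (m ^ p) (^-monoʳ-≤ c p≤r)) ⟩
  l ^ r * (c ^ r * m ^ p)   ≡⟨ ≡-sym (*-assoc (l ^ r) (c ^ r) (m ^ p)) ⟩
  l ^ r * c ^ r * m ^ p     ≡⟨ cong (_* m ^ p) (≡-sym (^-distrib-* l c r)) ⟩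
  (l * c) ^ r * m ^ p       ∎
  where open ≤-Reasoning

singletonTree : Graph
singletonTree = record { size = 1 ; adj = λ _ _ → false ; sym = λ _ _ → refl ; irrefl = λ _ → refl }

singletonTree-isTree : IsTree singletonTree
singletonTree-isTree = s≤s z≤n , connected , acyclic
  where
  connected : Connected singletonTree
  connected fzero fzero _ _ = here tt
  acyclic : Acyclic singletonTree
  acyclic C with Cycle.vtx C fzero | Cycle.vtx C (fsuc fzero) | Cycle.inj C {fzero} {fsuc fzero}
  ... | fzero | fzero | inj with inj refl
  ...   | ()

empty⇒TwAtMost-0 : (G : Graph) → (Fin (size G) → ⊥) → TwAtMost G 0
empty⇒TwAtMost-0 G noVertex = record
  { tree     = singletonTree
  ; isTree   = singletonTree-isTree
  ; bag      = λ _ → ∅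
  ; vcover   = λ v → ⊥-elim (noVertex v)
  ; ecover   = λ u _ _ → ⊥-elim (noVertex u)
  ; coherent = λ v → ⊥-elim (noVertex v)
  ; bagSize  = λ _ → ≤-trans (≤-reflexive (∣⊥∣≡0 (size G))) z≤n
  }

grid-1≼ : (G : Graph) → Fin (size G) → grid 1 ≼ G
grid-1≼ G v = record
  { branch    = λ _ → ⁅ v ⁆
  ; nonempty  = λ _ → v , x∈⁅x⁆ v
  ; connected = λ _ → singleton-connected
  ; disjoint  = λ { fzero fzero _ 0≢0 _ _ → 0≢0 refl }
  ; edges     = λ { fzero fzero () }
  }
  where
  singleton-connected : ConnectedIn G (λ x → x ∈ ⁅ v ⁆)
  singleton-connected x y x∈ y∈ with x∈⁅y⁆⇒x≡y v x∈ | x∈⁅y⁆⇒x≡y v y∈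
  ... | refl | refl = here x∈

module _ (Π : Problem) (closed : MinorClosed Π) (b : ℕ)
         (grid-lower : ∀ k m → OptAtMost Π (grid k) m → k * k ≤ b * m) where

  grid-excluded : ∀ G m t → OptAtMost Π G m → b * m < t * t → ¬ (grid t ≼ G)
  grid-excluded G m t opt bm<t² minor = <⇒≱ bm<t² (grid-lower t m (closed (grid t) G minor m opt))

  OptAtMost-0⇒empty : ∀ G → OptAtMost Π G 0 → Fin (size G) → ⊥
  OptAtMost-0⇒empty G opt v =
    grid-excluded G 0 1 opt (≤-<-trans (≤-reflexive (*-zeroʳ b)) (s≤s z≤n)) (grid-1≼ G v)

lemma1 : (𝒢 : Graph → Set) (Π : Problem) → SQGM 𝒢 → MinorBidimensional Π →
    ∃ λ α → ∃ λ p → ∃ λ q →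
      1 ≤ α × 0 < p × p < q ×
      (∀ G → 𝒢 G → ∀ m → OptAtMost Π G m →
         ∃ λ w → TwAtMost G w × w ^ q ≤ α ^ q * m ^ p)
-- Matching q and b as successors makes 0 ^ (2 * q) reduce and 4 * b NonZero.
lemma1 𝒢 Π (lam , p , q , 1≤lam , 1≤q@(s≤s _) , q≤p , p<2q , sqgm) (closed , b , 1≤b@(s≤s _) , grid-lower) =
  lam * (4 * b) , p , 2 * q , *-mono-≤ 1≤lam (s≤s z≤n) , ≤-trans 1≤q q≤p , p<2q , tw-bound
  where
  tw-bound : ∀ G → 𝒢 G → ∀ m → OptAtMost Π G m →
             ∃ λ w → TwAtMost G w × w ^ (2 * q) ≤ (lam * (4 * b)) ^ (2 * q) * m ^ p
  tw-bound G _  zero    opt = 0 , empty⇒TwAtMost-0 G (OptAtMost-0⇒empty Π closed b grid-lower G opt) , z≤n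
  tw-bound G G∈ (suc m) opt with square-between (b * suc m) (*-mono-≤ {1} {b} {1} {suc m} 1≤b (s≤s z≤n))
  ... | T , bm<T² , T²≤4bm with sqgm G G∈ T (grid-excluded Π closed b grid-lower G (suc m) T opt bm<T²)
  ...   | w , td , w^q≤ = w , td , ≤-trans
          (^-bound-squared w lam T p q w^q≤ (≤-trans T²≤4bm (≤-reflexive (≡-sym (*-assoc 4 b (suc m))))))
          (absorb-constant lam (4 * b) (suc m) (<⇒≤ p<2q))
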